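{- Let $(S,\circ,BB)$ be an Assembly Space and let $\mathscr{O}\in S$ be Binary Decomposable with $s(\mathscr{O})=2^n$ for some $n\in\mathbb{Z}_{\ge 0}$. Then \[ a(\mathscr{O})\;\le\;\sum_{i=1}^{n}\min\Big\{2^{\,n-i},\ \mathrm{Card}\big(S(2^i)\big)\Big\}. \]
   Context: A Multi-Magma $(S,\circ)$ is a set $S$ together with a binary operation $\circ:2^S\times 2^S\to 2^S$, extended element-wise: for $A,A'\subseteq S$, $A\circ A'=\bigcup_{x\in A,\,y\in A'}\{x\}\circ\{y\}$. A subset $BB\subseteq S$ is fixed as the set of Building Blocks. Assembly Addition Chains: for $\mathscr{O}\in S\setminus BB$, an AAC of $\mathscr{O}$ is a finite sequence $(\mathscr{O}_1,\dots,\mathscr{O}_r)$ of elements of $S$ with $\mathscr{O}_r=\mathscr{O}$, $\mathscr{O}_1\in\{\mathscr{B}\}\circ\{\mathscr{B}'\}$ for some $\mathscr{B},\mathscr{B}'\in BB$, and for each $\rho\in\{2,\dots,r\}$ there exist $\mathscr{O}_\sigma,\mathscr{O}_\tau\in\{\mathscr{O}_1,\dots,\mathscr{O}_{\rho-1}\}\cup BB$ with $\mathscr{O}_\rho\in\{\mathscr{O}_\sigma\}\circ\{\mathscr{O}_\tau\}$. Its length is $r$. Assembly Multi-Magma: for every $\mathscr{O}\in S\setminus BB$: (1) there exist $\mathscr{B}_0,\dots,\mathscr{B}_r\in BB$ and an AAC $\Gamma(\mathscr{O})=(\mathscr{O}_1,\dots,\mathscr{O}_r=\mathscr{O})$ with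 $\mathscr{O}_1\in\{\mathscr{B}_0\}\circ\{\mathscr{B}_1\}$, $\mathscr{O}_i\in\{\mathscr{O}_{i-1}\}\circ\{\mathscr{B}_i\}$ ($i\ge 2$); (2) any other such chain from blocks $\overline{\mathscr{B}}_0,\dots,\overline{\mathscr{B}}_s$ has $s=r$ and the blocks are a permutation of the $\mathscr{B}_i$. Size: $s(\mathscr{O})=1$ for $\mathscr{O}\in BB$, $s(\mathscr{O})=r+1$ otherwise. Assembly Space: additionally $s(\mathscr{O})=s(\mathscr{O}_\sigma)+s(\mathscr{O}_\tau)$ whenever $\mathscr{O}\in S\setminus BB$ and $\mathscr{O}\in\{\mathscr{O}_\sigma\}\circ\{\mathscr{O}_\tau\}$. Assembly Index: $a(\mathscr{O})=0$ for $\mathscr{O}\in BB$, otherwise the minimal length of an AAC of $\mathscr{O}$. $S(k)=\{\mathscr{O}\in S: s(\mathscr{O})=k\}$ and $\mathrm{Card}$ denotes cardinality. Balanced products: for $\mathscr{B}_1,\dots,\mathscr{B}_{2^m}\in BB$ define $T(\mathscr{B}_1)=\{\mathscr{B}_1\}$ and, for $m\ge1$, $T(\mathscr{B}_1,\dots,\mathscr{B}_{2^m})=T(\mathscr{B}_1,\dots,\mathscr{B}_{2^{m-1}})\circ T(\mathscr{B}_{2^{m-1}+1},\dots,\mathscr{B}_{2^m})$ (i.e. $((\mathscr{B}_1\circ\mathscr{B}_2)\circ(\mathscr{B}_3\circ\mathscr{B}_4))\circ\cdots$ with $m$ levels of pairwise gluing). Binary Decomposable objects: write $s(\mathscr{O})=2^{n_1}+2^{n_2}+\cdots+2^{n_H}$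 with $n_1>n_2>\cdots>n_H\ge0$ (binary expansion; $H=H(s(\mathscr{O}))$ is the Hamming weight). $\mathscr{O}$ is Binary Decomposable if there exist building blocks $\mathscr{B}^{(i)}_j\in BB$ ($i=1,\dots,H$, $j=1,\dots,2^{n_i}$) and objects $\mathscr{P}_i\in T(\mathscr{B}^{(i)}_1,\dots,\mathscr{B}^{(i)}_{2^{n_i}})$ such that $\mathscr{O}\in\{\mathscr{P}_H\}\circ\big(\cdots\circ(\{\mathscr{P}_3\}\circ(\{\mathscr{P}_2\}\circ\{\mathscr{P}_1\}))\cdots\big)$ (for $H=1$ this means $\mathscr{O}=\mathscr{P}_1$). -}

module Defs where

open import Data.Nat using (ℕ; zero; suc; _+_; _^_; _≤_; _<_; _∸_)
open import Data.Fin as Fin using (Fin; fromℕ)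
open import Data.List using (List; []; _∷_; length)
open import Data.List.Relation.Binary.Permutation.Propositional using (_↭_)
open import Data.Product using (Σ; ∃; ∃-syntax; _×_; _,_)
open import Data.Sum using (_⊎_)
open import Relation.Nullary using (¬_)
open import Relation.Binary.PropositionalEquality using (_≡_)

sumFrom1 : ℕ → (ℕ → ℕ) → ℕ
sumFrom1 zero    c = 0
sumFrom1 (suc n) c = sumFrom1 n c + c (suc n)

-- A multi-magma on S is given by its values on singletons:
-- op x y z  means  z ∈ {x} ∘ {y}.  BB is the set of building blocks.
module Assembly {S : Set} (BB : S → Set) (op : S → S → S → Set) where

  -- An AAC of length r = suc m is a map
  -- c : Fin (suc m) → S (c i = 𝒪_{i+1}) ending in O, where every entry
  -- is a product of two elements that are either building blocks or
  -- earlier entries of the chain (for the first entry: two blocks).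
  Avail : ∀ {r} → (Fin r → S) → Fin r → S → Set
  Avail c j x = (∃[ i ] (i Fin.< j × c i ≡ x)) ⊎ BB x

  AAC : S → ℕ → Set
  AAC O m = Σ (Fin (suc m) → S) λ c →
              (c (fromℕ m) ≡ O)
            × (∀ j → ∃[ x ] ∃[ y ] (Avail c j x × Avail c j y × op x y (c j)))

  IsAssemblyIndex : S → ℕ → Set
  IsAssemblyIndex O k =
      (BB O × k ≡ 0)
    ⊎ (¬ BB O × (∃[ m ] (k ≡ suc m × AAC O m)) × (∀ m → AAC O m → k ≤ suc m))

  -- Linear chains Γ(O): O_1 ∈ {B_0}∘{B_1}, O_i ∈ {O_{i-1}}∘{B_i}.
  -- Lin O bs : O is the last element of such a chain, bs = [B_r,…,B_1,B_0]
  -- (so length bs = r + 1).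
  data Lin : S → List S → Set where
    start : ∀ {b₀ b₁ o} → BB b₀ → BB b₁ → op b₀ b₁ o → Lin o (b₁ ∷ b₀ ∷ [])
    step  : ∀ {p b o bs} → Lin p bs → BB b → op p b o → Lin o (b ∷ bs)

  record IsAssemblyMultiMagma : Set where
    field
      existsChain : ∀ O → ¬ BB O → ∃[ bs ] Lin O bs
      uniqueBlocks : ∀ O → ¬ BB O → ∀ {bs bs'} → Lin O bs → Lin O bs' → bs ↭ bs'

  HasSize : S → ℕ → Set
  HasSize O k = (BB O × k ≡ 1) ⊎ (¬ BB O × ∃[ bs ] (Lin O bs × k ≡ length bs))

  record IsAssemblySpace : Set where
    field
      isAMM : IsAssemblyMultiMagma
      additive : ∀ {O x y kO kx ky} → ¬ BB O → op x y O →
                 HasSize O kO → HasSize x kx → HasSize y ky → kO ≡ kx + ky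

  -- Balanced products: T m f z  means  z ∈ T(f 0, …, f (2^m - 1)).
  T : ℕ → (ℕ → S) → S → Set
  T zero    f z = z ≡ f 0
  T (suc m) f z = ∃[ x ] ∃[ y ] (T m f x × T m (λ j → f (2 ^ m + j)) y × op x y z)

  InT : ℕ → S → Set
  InT m P = ∃[ f ] ((∀ j → j < 2 ^ m → BB (f j)) × T m f P)

  -- Nest ns O with ns = [n_H, …, n_2, n_1]:
  -- O ∈ {P_H} ∘ (⋯ ∘ ({P_2} ∘ {P_1})⋯) with P_i ∈ T(2^{n_i} blocks).
  data Nest : List ℕ → S → Set where
    one  : ∀ {n O} → InT n O → Nest (n ∷ []) O
    cons : ∀ {n ns P w O} → InT n P → Nest ns w → op P w O → Nest (n ∷ ns) O

  data Ascending : List ℕ → Set where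
    []  : Ascending []
    [-] : ∀ {n} → Ascending (n ∷ [])
    _∷_ : ∀ {m n ns} → m < n → Ascending (n ∷ ns) → Ascending (m ∷ n ∷ ns)

  sum2^ : List ℕ → ℕ
  sum2^ []       = 0
  sum2^ (n ∷ ns) = 2 ^ n + sum2^ ns

  BinaryDecomposable : S → Set
  BinaryDecomposable O =
    ∃[ ns ] (Ascending ns × HasSize O (sum2^ ns) × Nest ns O)

  -- MinCard k P c :  c = min{k, Card {x ∈ S | P x}}
  -- (either P has at least k distinct elements and c = k, or
  --  P has exactly c ≤ k elements).
  Injective : ∀ {r} → (Fin r → S) → Set
  Injective g = ∀ i j → g i ≡ g j → i ≡ j

  MinCard : ℕ → (S → Set) → ℕ → Set
  MinCard k P c =
      (c ≡ k × Σ (Fin k → S) λ g → Injective g × (∀ i → P (g i)))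
    ⊎ (c ≤ k × Σ (Fin c → S) λ g → Injective g × (∀ i → P (g i))
                                   × (∀ x → P x → ∃[ i ] (g i ≡ x)))

{-# OPTIONS --safe #-}
-- Since s(𝒪) = 2^n has a single binary digit, 𝒪 is a balanced product of 2^n building
-- blocks, and additivity of the size forces every node at depth d of this product tree to
-- have size 2^(n-d). Assemble the tree height by height: the nodes of size 2^i are products
-- of two nodes of size 2^(i-1); there are at most 2^(n-i) of them and all lie in S(2^i), so
-- at most min{2^(n-i), Card S(2^i)} distinct objects are added to the chain at height i.
module Submission where

open import Defs
open import Data.Nat using (ℕ; zero; suc; _+_; _^_; _≤_; _<_; _∸_; z≤n; s≤s)
open import Data.Nat.Properties
open import Data.Nat.Divisibility using (_∣_; _∣0; 1∣_; ∣m∣n⇒∣m+n; ∣m+n∣m⇒∣n; ∣⇒≤; *-monoʳ-∣)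
open import Data.Fin as Fin using (Fin; fromℕ; inject₁; toℕ)
open import Data.Fin.Properties using (toℕ-inject₁; toℕ-fromℕ; inject₁ℕ<)
open import Data.Fin.Relation.Unary.Top using (view; view-fromℕ; view-inject₁; ‵fromℕ; ‵inj₁)
open import Data.List using (List; []; _∷_; length; _++_; map; filter; allFin)
open import Data.List.Properties using (length-map; length-++; length-filter; length-tabulate)
open import Data.List.Membership.Propositional using (_∈_; mapWith∈)
open import Data.List.Membership.Propositional.Properties
  using (∈-++⁺ˡ; ∈-++⁺ʳ; ∈-++⁻; ∈-map⁺; ∈-map⁻; ∈-filter⁺; ∈-filter⁻; ∈-allFin)
open import Data.List.Relation.Unary.Any using (here; there)
open import Data.List.Relation.Unary.Any.Properties using (mapWith∈⁺; mapWith∈⁻)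
open import Data.List.Relation.Binary.Subset.Propositional using (_⊆_)
open import Data.List.Relation.Binary.Permutation.Propositional.Properties using (↭-length)
open import Data.Product using (∃; ∃-syntax; _×_; _,_; proj₁; proj₂)
open import Data.Sum using (_⊎_; inj₁; inj₂)
import Data.Sum as Sum
open import Effect.Monad using (RawMonad)
open import Function using (_∘_; id)
open import Level using (0ℓ)
open import Relation.Nullary using (¬_; contradiction; Dec; yes; no)
open import Relation.Nullary.Decidable using (decidable-stable; ¬¬-excluded-middle)
open import Relation.Nullary.Negation using (¬¬-Monad)
open import Relation.Binary.PropositionalEquality

open RawMonad (¬¬-Monad {0ℓ})

2^-mono-< : ∀ {a b} → a < b → 2 ^ a < 2 ^ b
2^-mono-< = ^-monoʳ-< 2 (s≤s (s≤s z≤n))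

2^-injective : ∀ {a b} → 2 ^ a ≡ 2 ^ b → a ≡ b
2^-injective eq = ≤-antisym (≮⇒≥ (λ b<a → <⇒≢ (2^-mono-< b<a) (sym eq)))
                            (≮⇒≥ (λ a<b → <⇒≢ (2^-mono-< a<b) eq))

2^∣2^ : ∀ {a b} → a ≤ b → 2 ^ a ∣ 2 ^ b
2^∣2^ {b = b} z≤n = 1∣ (2 ^ b)
2^∣2^ (s≤s a≤b)   = *-monoʳ-∣ 2 (2^∣2^ a≤b)

2^[1+m]≡2^m+2^m : ∀ m → 2 ^ suc m ≡ 2 ^ m + 2 ^ m
2^[1+m]≡2^m+2^m m = cong (2 ^ m +_) (+-identityʳ (2 ^ m))

m≤o⇒n≤o⇒m+n≡o+o⇒m≡o : ∀ {m n o} → m ≤ o → n ≤ o → m + n ≡ o + o → m ≡ o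
m≤o⇒n≤o⇒m+n≡o+o⇒m≡o {m} {n} {o} m≤o n≤o eq =
  ≤-antisym m≤o (+-cancelʳ-≤ o o m (subst (_≤ m + o) eq (+-monoʳ-≤ m n≤o)))

module AssemblyBounds {S : Set} (BB : S → Set) (op : S → S → S → Set) where
  open Assembly BB op

  2^∣sum2^ : ∀ {a b ns} → a ≤ b → Ascending (b ∷ ns) → 2 ^ a ∣ sum2^ (b ∷ ns)
  2^∣sum2^ {a} a≤b [-]         = ∣m∣n⇒∣m+n (2^∣2^ a≤b) (_ ∣0)
  2^∣sum2^ a≤b (b<c ∷ ascending) =
    ∣m∣n⇒∣m+n (2^∣2^ a≤b) (2^∣sum2^ (≤-trans a≤b (<⇒≤ b<c)) ascending)

  -- Only the smallest term 2^a is not divisible by 2^(a+1), while a power of two exceeding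
  -- 2^a is.
  sum2^≢2^ : ∀ {a b ns n} → Ascending (a ∷ b ∷ ns) → sum2^ (a ∷ b ∷ ns) ≢ 2 ^ n
  sum2^≢2^ {a} {b} {ns} {n} (a<b ∷ ascending) eq with ≤-<-connex n a
  ... | inj₁ n≤a = <⇒≢ (≤-<-trans (^-monoʳ-≤ 2 n≤a) 2^a<sum) (sym eq)
    where
    2^a<sum : 2 ^ a < 2 ^ a + sum2^ (b ∷ ns)
    2^a<sum = subst (_< 2 ^ a + sum2^ (b ∷ ns)) (+-identityʳ (2 ^ a))
                (+-monoʳ-< (2 ^ a) (≤-trans (m^n>0 2 b) (m≤m+n (2 ^ b) (sum2^ ns))))
  ... | inj₂ a<n = <⇒≱ (2^-mono-< (n<1+n a)) (∣⇒≤ {{m^n≢0 2 a}} 2^[1+a]∣2^a)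
    where
    2^[1+a]∣2^a : 2 ^ suc a ∣ 2 ^ a
    2^[1+a]∣2^a = ∣m+n∣m⇒∣n (subst (2 ^ suc a ∣_) (trans (sym eq) (+-comm (2 ^ a) _)) (2^∣2^ a<n))
                            (2^∣sum2^ a<b ascending)

  Nest⇒InT : ∀ {ns n O} → Ascending ns → sum2^ ns ≡ 2 ^ n → Nest ns O → InT n O
  Nest⇒InT [-] eq (one inT) =
    subst (λ m → InT m _) (2^-injective (trans (sym (+-identityʳ _)) eq)) inT
  Nest⇒InT [-] eq (cons _ () _)
  Nest⇒InT {n = n} ascending@(_ ∷ _) eq _ = contradiction eq (sum2^≢2^ {n = n} ascending)

  Available : List S → S → Set
  Available xs x = x ∈ xs ⊎ BB x

  Built : List S → S → Set
  Built xs z = ∃[ x ] ∃[ y ] (Available xs x × Available xs y × op x y z)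

  -- Chains are listed newest element first.
  data Chain : List S → Set where
    []  : Chain []
    _∷_ : ∀ {z xs} → Built xs z → Chain xs → Chain (z ∷ xs)

  Built-mono : ∀ {xs ys z} → xs ⊆ ys → Built xs z → Built ys z
  Built-mono xs⊆ys (x , y , x∈ , y∈ , xy↦z) =
    x , y , Sum.map₁ xs⊆ys x∈ , Sum.map₁ xs⊆ys y∈ , xy↦z

  Chain-++ : ∀ {xs ys} → (∀ {y} → y ∈ ys → Built xs y) → Chain xs → Chain (ys ++ xs)
  Chain-++ {ys = []}     built chain = chain
  Chain-++ {ys = y ∷ ys} built chain =
    Built-mono (∈-++⁺ʳ ys) (built (here refl)) ∷ Chain-++ (built ∘ there) chain

  IsAAC : ∀ {r} → (Fin r → S) → Set
  IsAAC c = ∀ j → ∃[ x ] ∃[ y ] (Avail c j x × Avail c j y × op x y (c j))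

  snoc : ∀ {r} → (Fin r → S) → S → Fin (suc r) → S
  snoc c z j with view j
  ... | ‵fromℕ          = z
  ... | ‵inj₁ {i = i} _ = c i

  snoc-fromℕ : ∀ {r} (c : Fin r → S) z → snoc c z (fromℕ r) ≡ z
  snoc-fromℕ {r} c z rewrite view-fromℕ r = refl

  snoc-inject₁ : ∀ {r} (c : Fin r → S) z i → snoc c z (inject₁ i) ≡ c i
  snoc-inject₁ c z i rewrite view-inject₁ i = refl

  enumerate : (xs : List S) → Fin (length xs) → S
  enumerate []       ()
  enumerate (z ∷ xs) = snoc (enumerate xs) z

  enumerate-∈ : ∀ {x xs} → x ∈ xs → ∃[ i ] (enumerate xs i ≡ x)
  enumerate-∈ {xs = x ∷ xs} (here refl) = fromℕ (length xs) , snoc-fromℕ (enumerate xs) x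
  enumerate-∈ {xs = z ∷ xs} (there x∈) =
    let i , eq = enumerate-∈ x∈ in inject₁ i , trans (snoc-inject₁ (enumerate xs) z i) eq

  Avail-snoc : ∀ {r} (c : Fin r → S) z {i x} → Avail c i x → Avail (snoc c z) (inject₁ i) x
  Avail-snoc c z {i} (inj₁ (k , k<i , refl)) =
    inj₁ (inject₁ k , subst₂ _<_ (sym (toℕ-inject₁ k)) (sym (toℕ-inject₁ i)) k<i , snoc-inject₁ c z k)
  Avail-snoc c z (inj₂ bb) = inj₂ bb

  Available⇒Avail-last : ∀ {xs z x} → Available xs x → Avail (enumerate (z ∷ xs)) (fromℕ (length xs)) x
  Available⇒Avail-last {xs} {z} (inj₁ x∈) =
    let i , eq = enumerate-∈ x∈ in
    inj₁ (inject₁ i , subst (toℕ (inject₁ i) <_) (sym (toℕ-fromℕ (length xs))) (inject₁ℕ< i)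
         , trans (snoc-inject₁ (enumerate xs) z i) eq)
  Available⇒Avail-last (inj₂ bb) = inj₂ bb

  Chain⇒IsAAC : ∀ {xs} → Chain xs → IsAAC (enumerate xs)
  Chain⇒IsAAC {z ∷ xs} (built ∷ chain) j with view j
  ... | ‵fromℕ =
    let x , y , x∈ , y∈ , xy↦z = built in
    x , y , Available⇒Avail-last x∈ , Available⇒Avail-last y∈ , xy↦z
  ... | ‵inj₁ {i = i} _ =
    let x , y , x∈ , y∈ , xy↦ = Chain⇒IsAAC chain i in
    x , y , Avail-snoc (enumerate xs) z x∈ , Avail-snoc (enumerate xs) z y∈ , xy↦

  ∈-Chain⇒AAC : ∀ {xs z} → Chain xs → z ∈ xs → ∃[ m ] (AAC z m × m < length xs)
  ∈-Chain⇒AAC {z ∷ xs} chain (here refl) =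
    length xs , (enumerate (z ∷ xs) , snoc-fromℕ (enumerate xs) z , Chain⇒IsAAC chain) , n<1+n _
  ∈-Chain⇒AAC (_ ∷ chain) (there z∈) =
    let m , aac , m< = ∈-Chain⇒AAC chain z∈ in m , aac , m<n⇒m<1+n m<

  AtMostDistinct : ℕ → List S → Set
  AtMostDistinct w xs = ∃[ ys ] (length ys ≤ w × ys ⊆ xs × xs ⊆ ys)

  image⇒AtMostDistinct : ∀ {c xs} (g : Fin c → S) → (∀ {x} → x ∈ xs → ∃[ j ] (g j ≡ x)) →
                         AtMostDistinct c xs
  image⇒AtMostDistinct {c} {xs} g onto = map g hit , length≤c , sound , complete
    where
    indices : List (Fin c)
    indices = mapWith∈ xs (proj₁ ∘ onto)

    open import Data.List.Membership.DecPropositional (Fin._≟_ {c}) using (_∈?_)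

    hit : List (Fin c)
    hit = filter (_∈? indices) (allFin c)

    length≤c : length (map g hit) ≤ c
    length≤c = begin
      length (map g hit)   ≡⟨ length-map g hit ⟩
      length hit           ≤⟨ length-filter (_∈? indices) (allFin c) ⟩
      length (allFin c)    ≡⟨ length-tabulate id ⟩
      c                    ∎
      where open ≤-Reasoning

    sound : map g hit ⊆ xs
    sound y∈ =
      let j , j∈ , y≡gj = ∈-map⁻ g y∈
          x , x∈ , j≡   = mapWith∈⁻ xs (proj₁ ∘ onto) (proj₂ (∈-filter⁻ (_∈? indices) {xs = allFin c} j∈))
      in subst (_∈ xs) (sym (trans y≡gj (trans (cong g j≡) (proj₂ (onto x∈))))) x∈

    complete : xs ⊆ map g hit
    complete x∈ =
      subst (_∈ map g hit) (proj₂ (onto x∈))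
        (∈-map⁺ g (∈-filter⁺ (_∈? indices) (∈-allFin _) (mapWith∈⁺ (proj₁ ∘ onto) (_ , x∈ , refl))))

  MinCard⇒AtMostDistinct : ∀ {k P c xs} → MinCard k P c → (∀ {x} → x ∈ xs → P x) → length xs ≤ k →
                           AtMostDistinct c xs
  MinCard⇒AtMostDistinct {xs = xs} (inj₁ (refl , _)) _ length≤k = xs , length≤k , id , id
  MinCard⇒AtMostDistinct (inj₂ (_ , g , _ , _ , onto)) P-of _ = image⇒AtMostDistinct g (onto _ ∘ P-of)

  ChainReaching : ℕ → List S → Set
  ChainReaching bound targets =
    ∃[ xs ] (Chain xs × length xs ≤ bound × (∀ {x} → x ∈ targets → Available xs x))

  ChainReaching⇒AAC : ∀ {bound targets z} → ChainReaching bound targets → z ∈ targets → ¬ BB z →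
                      ∃[ m ] (AAC z m × m < bound)
  ChainReaching⇒AAC (xs , chain , length≤ , reached) z∈ ¬bb with reached z∈
  ... | inj₁ z∈xs = let m , aac , m< = ∈-Chain⇒AAC chain z∈xs in m , aac , <-≤-trans m< length≤
  ... | inj₂ bb   = contradiction bb ¬bb

  -- Each layer is assembled from the previous one, one new chain element per distinct object.
  layered-chain : ∀ n (layer : ℕ → List S) (width : ℕ → ℕ) →
    (∀ {x} → x ∈ layer 0 → BB x) →
    (∀ {i x} → i < n → x ∈ layer (suc i) → ∃[ a ] ∃[ b ] (a ∈ layer i × b ∈ layer i × op a b x)) →
    (∀ {i} → i < n → AtMostDistinct (width (suc i)) (layer (suc i))) →
    ∀ {i} → i ≤ n → ChainReaching (sumFrom1 i width) (layer i)
  layered-chain n layer width bottom assembled few {zero} _ = [] , [] , z≤n , inj₂ ∘ bottom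
  layered-chain n layer width bottom assembled few {suc i} i<n
    with xs , chain , length≤ , reached ← layered-chain n layer width bottom assembled few (<⇒≤ i<n)
       | ys , length-ys≤ , ys⊆ , ⊆ys ← few i<n
       = ys ++ xs , Chain-++ built chain , length≤sum , inj₁ ∘ ∈-++⁺ˡ ∘ ⊆ys
    where
    built : ∀ {y} → y ∈ ys → Built xs y
    built y∈ = let a , b , a∈ , b∈ , ab↦y = assembled i<n (ys⊆ y∈) in
               a , b , reached a∈ , reached b∈ , ab↦y

    length≤sum : length (ys ++ xs) ≤ sumFrom1 i width + width (suc i)
    length≤sum = begin
      length (ys ++ xs)                    ≡⟨ length-++ ys ⟩
      length ys + length xs                ≤⟨ +-mono-≤ length-ys≤ length≤ ⟩
      width (suc i) + sumFrom1 i width     ≡⟨ +-comm (width (suc i)) _ ⟩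
      sumFrom1 i width + width (suc i)     ∎
      where open ≤-Reasoning

  Leaves : ℕ → (ℕ → S) → Set
  Leaves m f = ∀ j → j < 2 ^ m → BB (f j)

  Leaves-left : ∀ m {f} → Leaves (suc m) f → Leaves m f
  Leaves-left m leaves j j< = leaves j (≤-trans j< (m≤m+n (2 ^ m) _))

  Leaves-right : ∀ m {f} → Leaves (suc m) f → Leaves m (λ j → f (2 ^ m + j))
  Leaves-right m leaves j j< =
    leaves (2 ^ m + j) (subst (2 ^ m + j <_) (sym (2^[1+m]≡2^m+2^m m)) (+-monoʳ-< (2 ^ m) j<))

  -- The nodes at depth d of the product tree, with repetitions.
  level : ∀ m {f z} → T m f z → ℕ → List S
  level m       {z = z} _                  zero    = z ∷ []
  level zero    _                          (suc d) = []
  level (suc m) (_ , _ , tx , ty , _)      (suc d) = level m tx d ++ level m ty d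

  length-level : ∀ m {f z} (t : T m f z) d → length (level m t d) ≤ 2 ^ d
  length-level m       t                   zero    = ≤-refl
  length-level zero    t                   (suc d) = z≤n
  length-level (suc m) (_ , _ , tx , ty , _) (suc d) = begin
    length (level m tx d ++ level m ty d)           ≡⟨ length-++ (level m tx d) ⟩
    length (level m tx d) + length (level m ty d)   ≤⟨ +-mono-≤ (length-level m tx d) (length-level m ty d) ⟩
    2 ^ d + 2 ^ d                                   ≡⟨ sym (2^[1+m]≡2^m+2^m d) ⟩
    2 ^ suc d                                       ∎
    where open ≤-Reasoning

  level-leaves : ∀ m {f z} → Leaves m f → (t : T m f z) → ∀ {x} → x ∈ level m t m → BB x
  level-leaves zero    leaves refl (here refl) = leaves 0 (s≤s z≤n)
  level-leaves (suc m) leaves (_ , _ , tx , ty , _) x∈ with ∈-++⁻ (level m tx m) x∈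
  ... | inj₁ x∈l = level-leaves m (Leaves-left m leaves) tx x∈l
  ... | inj₂ x∈r = level-leaves m (Leaves-right m leaves) ty x∈r

  level-children : ∀ m {f z} (t : T m f z) {d x} → d < m → x ∈ level m t d →
    ∃[ a ] ∃[ b ] (a ∈ level m t (suc d) × b ∈ level m t (suc d) × op a b x)
  level-children (suc m) (x , y , tx , _ , xy↦z) {zero} _ (here refl) =
    x , y , here refl , ∈-++⁺ʳ (level m tx 0) (here refl) , xy↦z
  level-children (suc m) (_ , _ , tx , ty , _) {suc d} (s≤s d<m) x∈ with ∈-++⁻ (level m tx d) x∈
  ... | inj₁ x∈l = let a , b , a∈ , b∈ , ab↦x = level-children m tx d<m x∈l in
                   a , b , ∈-++⁺ˡ a∈ , ∈-++⁺ˡ b∈ , ab↦x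
  ... | inj₂ x∈r = let a , b , a∈ , b∈ , ab↦x = level-children m ty d<m x∈r in
                   a , b , ∈-++⁺ʳ (level m tx (suc d)) a∈ , ∈-++⁺ʳ (level m tx (suc d)) b∈ , ab↦x

  LevelsSized : ∀ m {f z} → T m f z → Set
  LevelsSized m t = ∀ {d x} → d ≤ m → x ∈ level m t d → HasSize x (2 ^ (m ∸ d))

  balanced-AAC : ∀ {n f O} (c : ℕ → ℕ) → Leaves n f → (t : T n f O) → ¬ BB O →
    LevelsSized n t →
    (∀ i → 1 ≤ i → i ≤ n → MinCard (2 ^ (n ∸ i)) (λ x → HasSize x (2 ^ i)) (c i)) →
    ∃[ m ] (AAC O m × m < sumFrom1 n c)
  balanced-AAC {n} {O = O} c leaves t ¬bb sizes minCard =
    ChainReaching⇒AAC (layered-chain n layer c (level-leaves n leaves t) assembled few ≤-refl) O∈layer-n ¬bb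
    where
    layer : ℕ → List S
    layer i = level n t (n ∸ i)

    O∈layer-n : O ∈ layer n
    O∈layer-n = subst (λ d → O ∈ level n t d) (sym (n∸n≡0 n)) (here refl)

    assembled : ∀ {i x} → i < n → x ∈ layer (suc i) →
                ∃[ a ] ∃[ b ] (a ∈ layer i × b ∈ layer i × op a b x)
    assembled {i} {x} i<n x∈ =
      subst (λ d → ∃[ a ] ∃[ b ] (a ∈ level n t d × b ∈ level n t d × op a b x))
            (sym (+-∸-assoc 1 i<n))
            (level-children n t (∸-monoʳ-< (s≤s z≤n) i<n) x∈)

    few : ∀ {i} → i < n → AtMostDistinct (c (suc i)) (layer (suc i))
    few {i} i<n =
      MinCard⇒AtMostDistinct (minCard (suc i) (s≤s z≤n) i<n)
        (λ {x} x∈ → subst (λ e → HasSize x (2 ^ e)) (m∸[m∸n]≡n i<n) (sizes (m∸n≤m n (suc i)) x∈))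
        (length-level n t (n ∸ suc i))

  module Sizes (assemblySpace : IsAssemblySpace) where
    open IsAssemblySpace assemblySpace
    open IsAssemblyMultiMagma isAMM

    HasSize-functional : ∀ {x a b} → HasSize x a → HasSize x b → a ≡ b
    HasSize-functional (inj₁ (_ , refl)) (inj₁ (_ , refl))  = refl
    HasSize-functional (inj₁ (bb , _))   (inj₂ (¬bb , _))   = contradiction bb ¬bb
    HasSize-functional (inj₂ (¬bb , _))  (inj₁ (bb , _))    = contradiction bb ¬bb
    HasSize-functional {x} (inj₂ (¬bb , _ , lin , refl)) (inj₂ (_ , _ , lin′ , refl)) =
      ↭-length (uniqueBlocks x ¬bb lin lin′)

    -- Every object has a size, but only classically: whether it is a building block is
    -- undecidable. The theorem's conclusion is decidable, so this suffices.
    ¬¬-HasSize : ∀ x → ¬ ¬ ∃ (HasSize x)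
    ¬¬-HasSize x = do
      bb? ← ¬¬-excluded-middle
      pure (sized bb?)
      where
      sized : Dec (BB x) → ∃ (HasSize x)
      sized (yes bb)  = 1 , inj₁ (bb , refl)
      sized (no ¬bb)  = let bs , lin = existsChain x ¬bb in length bs , inj₂ (¬bb , bs , lin , refl)

    BB⇒HasSize≡1 : ∀ {x s} → BB x → HasSize x s → s ≡ 1
    BB⇒HasSize≡1 bb size = HasSize-functional size (inj₁ (bb , refl))

    HasSize-2^[1+m]⇒¬BB : ∀ {x m} → HasSize x (2 ^ suc m) → ¬ BB x
    HasSize-2^[1+m]⇒¬BB {m = m} size bb = <⇒≢ (2^-mono-< {0} {suc m} (s≤s z≤n)) (sym (BB⇒HasSize≡1 bb size))

    T-size≤ : ∀ m {f z s} → Leaves m f → T m f z → HasSize z s → s ≤ 2 ^ m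
    T-size≤ zero    leaves refl size               = ≤-reflexive (BB⇒HasSize≡1 (leaves 0 (s≤s z≤n)) size)
    T-size≤ (suc m) leaves _    (inj₁ (_ , refl)) = m^n>0 2 (suc m)
    T-size≤ (suc m) {s = s} leaves (x , y , tx , ty , xy↦z) size@(inj₂ (¬bb , _)) =
      decidable-stable (s ≤? 2 ^ suc m) do
        sx , size-x ← ¬¬-HasSize x
        sy , size-y ← ¬¬-HasSize y
        pure (begin
          s          ≡⟨ additive ¬bb xy↦z size size-x size-y ⟩
          sx + sy    ≤⟨ +-mono-≤ (T-size≤ m (Leaves-left m leaves) tx size-x)
                                 (T-size≤ m (Leaves-right m leaves) ty size-y) ⟩
          2 ^ m + 2 ^ m  ≡⟨ sym (2^[1+m]≡2^m+2^m m) ⟩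
          2 ^ suc m  ∎)
      where open ≤-Reasoning

    -- Both halves have size at most 2^m, and by additivity their sizes add up to 2^(m+1).
    T-halves : ∀ m {f x y z} → Leaves (suc m) f → T m f x → T m (λ j → f (2 ^ m + j)) y → op x y z →
               HasSize z (2 ^ suc m) → ¬ ¬ (HasSize x (2 ^ m) × HasSize y (2 ^ m))
    T-halves m {x = x} {y} leaves tx ty xy↦z size = do
      sx , size-x ← ¬¬-HasSize x
      sy , size-y ← ¬¬-HasSize y
      let sx≤ = T-size≤ m (Leaves-left m leaves) tx size-x
          sy≤ = T-size≤ m (Leaves-right m leaves) ty size-y
          sum≡ = trans (sym (additive (HasSize-2^[1+m]⇒¬BB {m = m} size) xy↦z size size-x size-y))
                       (2^[1+m]≡2^m+2^m m)
      pure ( subst (HasSize x) (m≤o⇒n≤o⇒m+n≡o+o⇒m≡o sx≤ sy≤ sum≡) size-x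
           , subst (HasSize y) (m≤o⇒n≤o⇒m+n≡o+o⇒m≡o sy≤ sx≤ (trans (+-comm sy sx) sum≡)) size-y)

    level-sizes : ∀ m {f z} → Leaves m f → (t : T m f z) → HasSize z (2 ^ m) → ¬ ¬ LevelsSized m t
    level-sizes zero    leaves t size = pure λ { z≤n (here refl) → size }
    level-sizes (suc m) leaves t@(x , y , tx , ty , xy↦z) size = do
      size-x , size-y ← T-halves m leaves tx ty xy↦z size
      sizes-x ← level-sizes m (Leaves-left m leaves) tx size-x
      sizes-y ← level-sizes m (Leaves-right m leaves) ty size-y
      pure (λ {d} {w} → combine sizes-x sizes-y {d} {w})
      where
      combine : LevelsSized m tx → LevelsSized m ty → LevelsSized (suc m) t
      combine _       _       {zero}  _         (here refl) = size
      combine sizes-x sizes-y {suc d} (s≤s d≤m) w∈ with ∈-++⁻ (level m tx d) w∈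
      ... | inj₁ w∈l = sizes-x d≤m w∈l
      ... | inj₂ w∈r = sizes-y d≤m w∈r

lemma1 : (S : Set) (BB : S → Set) (op : S → S → S → Set) →
         Assembly.IsAssemblySpace BB op →
         (O : S) (n : ℕ) →
         Assembly.BinaryDecomposable BB op O →
         Assembly.HasSize BB op O (2 ^ n) →
         (c : ℕ → ℕ) →
         (∀ i → 1 ≤ i → i ≤ n → Assembly.MinCard BB op (2 ^ (n ∸ i)) (λ x → Assembly.HasSize BB op x (2 ^ i)) (c i)) →
         (k : ℕ) → Assembly.IsAssemblyIndex BB op O k →
         k ≤ sumFrom1 n c
lemma1 S BB op assemblySpace O n _ _ c _ k (inj₁ (_ , refl)) = z≤n
lemma1 S BB op assemblySpace O n (_ , ascending , size , nest) size-2^n c minCard k (inj₂ (¬bb , _ , minimal))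
  = let f , leaves , t = Nest⇒InT ascending (HasSize-functional size size-2^n) nest in
    decidable-stable (k ≤? sumFrom1 n c) do
      sizes ← level-sizes n leaves t size-2^n
      let m , aac , m<sum = balanced-AAC c leaves t ¬bb sizes minCard
      pure (≤-trans (minimal m aac) m<sum)
  where
  open AssemblyBounds BB op
  open Sizes assemblySpace
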